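{- If $f_1 f_2 \cdots f_z$ is the LZ-End parsing of a string $s$, then, for any letter $a$, the last phrase in the LZ-End parsing of the string $sa$ is either $f_{z-1} f_z a$, or $f_z a$, or $a$.
   Context: For a string $s$, $s[i..j] = s[i]s[i+1]\cdots s[j]$. The LZ-End parsing of $s$ is the decomposition $s = f_1 f_2 \cdots f_z$ built greedily from left to right: if a prefix $s[1..k] = f_1 f_2\cdots f_{i-1}$ has already been parsed, then $f_i[1..|f_i|-1]$ is the longest prefix of $s[k+1..|s|-1]$ that is a suffix of some string $f_1 f_2 \cdots f_j$ with $j < i$ (the empty string counts as such a suffix), and $f_i$ is this prefix extended by the next letter of $s$. The substrings $f_i$ are called phrases. -}

module Defs where

open import Data.Nat using (ℕ; _≤_)
open import Data.List using (List; []; _∷_; _++_; [_]; concat; length; take; drop; lookup)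
open import Data.Fin using (Fin; toℕ)
open import Data.Product using (Σ; ∃; _×_)
open import Relation.Binary.PropositionalEquality using (_≡_)

IsPrefix : {A : Set} → List A → List A → Set
IsPrefix {A} x y = Σ (List A) λ t → x ++ t ≡ y

IsSuffix : {A : Set} → List A → List A → Set
IsSuffix {A} x y = Σ (List A) λ t → t ++ x ≡ y

SuffixOfSomePrefixParse : {A : Set} → List (List A) → List A → Set
SuffixOfSomePrefixParse prev p = ∃ λ j → j ≤ length prev × IsSuffix p (concat (take j prev))

-- Given the string s and the already-parsed phrases prev = f_1 ... f_{i-1}
-- (with s = f_1 ... f_{i-1} ++ rest), f is the phrase f_i chosen by LZ-End:
-- f = p ++ [c], where p ++ [c] is a prefix of rest (so p is a prefix of
-- s[k+1..|s|-1] and c is the next letter), p is a suffix of some f_1...f_j (j < i),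
-- and p is longest among all such candidates.
NextPhrase : {A : Set} → List A → List (List A) → List A → Set
NextPhrase {A} s prev f =
  let rest = drop (length (concat prev)) s in
  Σ (List A) λ p → Σ A λ c →
    f ≡ p ++ [ c ]
    × IsPrefix (p ++ [ c ]) rest
    × SuffixOfSomePrefixParse prev p
    × (∀ (q : List A) (d : A) → IsPrefix (q ++ [ d ]) rest →
         SuffixOfSomePrefixParse prev q → length q ≤ length p)

IsLZEnd : {A : Set} → List A → List (List A) → Set
IsLZEnd s fs =
  concat fs ≡ s
  × (∀ (i : Fin (length fs)) → NextPhrase s (take (toℕ i) fs) (lookup fs i))

-- LZ-End chooses a phrase by looking only at the text up to its end, so every phrase of
-- the parsing of sa except the last is also a phrase of the parsing of s. Hence the last
-- phrase of sa is w a, where w = f_k ⋯ f_z is a suffix of the text of some phrases before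
-- f_k. If w consisted of three or more phrases, take the phrase x = p c ending that
-- occurrence of w. If x started after f_k ends, the part of w before x would have been a
-- longer choice for f_k; otherwise the source p of x covers f_{k+1} ⋯ f_z minus its last
-- letter, which would have been a longer choice for f_{k+1}.
module Submission where

open import Defs
open import Data.List using (List; []; _∷_; _++_; [_]; concat; length; take; drop; lookup; initLast; _∷ʳ′_)
open import Data.List.Properties using (++-assoc; ++-identityʳ; length-++; length-++-≤ˡ; concat-++; take++drop≡id; ∷-injective; ∷ʳ-injectiveˡ; ++-cancelˡ; ++-conicalˡ; ++-conicalʳ)
open import Data.Nat using (suc; _≤_; _<_; z≤n; s≤s)
open import Data.Nat.Properties using (≤-trans; ≤-antisym; <-trans; ≤-<-trans; <⇒≤; <⇒≱; ≮⇒≥; +-monoˡ-≤; +-cancelˡ-<; suc-injective)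
open import Data.Fin using (Fin; toℕ)
import Data.Fin as Fin
open import Data.Product using (Σ; ∃; ∃₂; _×_; _,_; proj₁; proj₂)
open import Data.Sum using (_⊎_; inj₁; inj₂)
open import Data.Empty using (⊥; ⊥-elim)
open import Relation.Nullary using (¬_)
open import Relation.Binary.PropositionalEquality using (_≡_; _≢_; refl; sym; trans; cong; subst; subst₂; module ≡-Reasoning)

module _ {B : Set} where

  take-length-++ : (xs ys : List B) → take (length xs) (xs ++ ys) ≡ xs
  take-length-++ []       ys = refl
  take-length-++ (x ∷ xs) ys = cong (x ∷_) (take-length-++ xs ys)

  drop-length-++ : (xs ys : List B) → drop (length xs) (xs ++ ys) ≡ ys
  drop-length-++ []       ys = refl
  drop-length-++ (x ∷ xs) ys = drop-length-++ xs ys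

  lookup-length-++ : (xs : List B) (y : B) (ys : List B) →
    ∃ λ (i : Fin (length (xs ++ y ∷ ys))) → toℕ i ≡ length xs × lookup (xs ++ y ∷ ys) i ≡ y
  lookup-length-++ []       y ys = Fin.zero , refl , refl
  lookup-length-++ (x ∷ xs) y ys with lookup-length-++ xs y ys
  ... | i , i≡ , lookup≡ = Fin.suc i , cong suc i≡ , lookup≡

  ∷ʳ-≢-[] : (xs : List B) {x : B} → xs ++ [ x ] ≢ []
  ∷ʳ-≢-[] []      ()
  ∷ʳ-≢-[] (_ ∷ _) ()

  length-<-++ : (xs : List B) {ys : List B} → ys ≢ [] → length xs < length (xs ++ ys)
  length-<-++ []       {[]}    ys≢[] = ⊥-elim (ys≢[] refl)
  length-<-++ []       {_ ∷ _} _     = s≤s z≤n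
  length-<-++ (x ∷ xs)         ys≢[] = s≤s (length-<-++ xs ys≢[])

  IsPrefix-trans : {xs ys zs : List B} → IsPrefix xs ys → IsPrefix ys zs → IsPrefix xs zs
  IsPrefix-trans {xs} (t , refl) (u , refl) = t ++ u , sym (++-assoc xs t u)

  IsSuffix-trans : {xs ys zs : List B} → IsSuffix xs ys → IsSuffix ys zs → IsSuffix xs zs
  IsSuffix-trans {xs} (t , refl) (u , refl) = u ++ t , ++-assoc u t xs

  IsPrefix-unique : {xs ys zs : List B} → IsPrefix xs zs → IsPrefix ys zs →
    length xs ≡ length ys → xs ≡ ys
  IsPrefix-unique {[]}     {[]}     _          _       _ = refl
  IsPrefix-unique {x ∷ xs} {y ∷ ys} (t , refl) (u , e) l with ∷-injective e
  ... | refl , e′ = cong (x ∷_) (IsPrefix-unique (t , refl) (u , e′) (suc-injective l))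

  ++-split : (xs ys us vs : List B) → xs ++ ys ≡ us ++ vs → length us ≤ length xs →
    ∃ λ q → xs ≡ us ++ q × q ++ ys ≡ vs
  ++-split xs       ys []       vs e _ = xs , refl , e
  ++-split (x ∷ xs) ys (u ∷ us) vs e (s≤s us≤xs) with ∷-injective e
  ... | refl , e′ with ++-split xs ys us vs e′ us≤xs
  ...   | q , refl , q++ys≡vs = q , refl , q++ys≡vs

  ++-∷ʳ-prefix : (xs ys zs : List B) {z : B} → xs ++ ys ≡ zs ++ [ z ] → ys ≢ [] → IsPrefix xs zs
  ++-∷ʳ-prefix []       ys zs       _ _     = zs , refl
  ++-∷ʳ-prefix (x ∷ xs) ys []       e ys≢[] = ⊥-elim (ys≢[] (++-conicalʳ xs ys (proj₂ (∷-injective e))))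
  ++-∷ʳ-prefix (x ∷ xs) ys (z ∷ zs) e ys≢[] with ∷-injective e
  ... | refl , e′ with ++-∷ʳ-prefix xs ys zs e′ ys≢[]
  ...   | w , refl = w , refl

  ∷ʳ-overlap-suffix : (b p us v : List B) {c d : B} → b ++ p ++ [ c ] ≡ us ++ v ++ [ d ] →
    length b ≤ length us → IsSuffix v p
  ∷ʳ-overlap-suffix b p us v e b≤us with ++-split us v b p (sym b++p≡us++v) b≤us
    where
    open ≡-Reasoning
    b++p≡us++v : b ++ p ≡ us ++ v
    b++p≡us++v = ∷ʳ-injectiveˡ (b ++ p) (us ++ v) (begin
      (b ++ p) ++ [ _ ]    ≡⟨ ++-assoc b p _ ⟩
      b ++ p ++ [ _ ]      ≡⟨ e ⟩
      us ++ v ++ [ _ ]     ≡⟨ ++-assoc us v _ ⟨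
      (us ++ v) ++ [ _ ]   ∎)
  ... | q , _ , q++v≡p = q , q++v≡p

module _ {A : Set} where

  SuffixOfSomePrefixParse-intro : {prev xs : List (List A)} {p : List A} →
    IsPrefix xs prev → IsSuffix p (concat xs) → SuffixOfSomePrefixParse prev p
  SuffixOfSomePrefixParse-intro {xs = xs} {p} (ys , refl) p≤xs =
    length xs , length-++-≤ˡ xs , subst (λ zs → IsSuffix p (concat zs)) (sym (take-length-++ xs ys)) p≤xs

  SuffixOfSomePrefixParse-witness : {prev : List (List A)} {p : List A} →
    SuffixOfSomePrefixParse prev p → ∃ λ xs → IsPrefix xs prev × IsSuffix p (concat xs)
  SuffixOfSomePrefixParse-witness {prev} (j , _ , p≤xs) = take j prev , (drop j prev , take++drop≡id j prev) , p≤xs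

  SuffixOfSomePrefixParse-mono : {prev prev′ : List (List A)} {p : List A} → IsPrefix prev prev′ →
    SuffixOfSomePrefixParse prev p → SuffixOfSomePrefixParse prev′ p
  SuffixOfSomePrefixParse-mono prev≤prev′ src with SuffixOfSomePrefixParse-witness src
  ... | xs , xs≤prev , p≤xs = SuffixOfSomePrefixParse-intro (IsPrefix-trans xs≤prev prev≤prev′) p≤xs

  SuffixOfSomePrefixParse-suffix : {prev : List (List A)} {p v : List A} → IsSuffix v p →
    SuffixOfSomePrefixParse prev p → SuffixOfSomePrefixParse prev v
  SuffixOfSomePrefixParse-suffix v≤p (j , j≤ , p≤xs) = j , j≤ , IsSuffix-trans v≤p p≤xs

  NextPhrase-nonempty : {s : List A} {prev : List (List A)} {f : List A} → NextPhrase s prev f → f ≢ []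
  NextPhrase-nonempty (p , _ , refl , _) = ∷ʳ-≢-[] p

  NextPhrase-prefix : {s rest : List A} {prev : List (List A)} {f : List A} →
    NextPhrase s prev f → concat prev ++ rest ≡ s → IsPrefix f rest
  NextPhrase-prefix {rest = rest} {prev} (p , c , refl , f≤ , _) refl =
    subst (IsPrefix (p ++ [ c ])) (drop-length-++ (concat prev) rest) f≤

  NextPhrase-longest : {s rest : List A} {prev : List (List A)} {f q : List A} {d : A} →
    NextPhrase s prev f → concat prev ++ rest ≡ s →
    IsPrefix (q ++ [ d ]) rest → SuffixOfSomePrefixParse prev q → length (q ++ [ d ]) ≤ length f
  NextPhrase-longest {rest = rest} {prev} {q = q} {d} (p , c , refl , _ , _ , longest) refl qd≤rest src =
    subst₂ _≤_ (sym (length-++ q)) (sym (length-++ p)) (+-monoˡ-≤ 1 (longest q d qd≤ src))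
    where
    qd≤ : IsPrefix (q ++ [ d ]) (drop (length (concat prev)) (concat prev ++ rest))
    qd≤ = subst (IsPrefix (q ++ [ d ])) (sym (drop-length-++ (concat prev) rest)) qd≤rest

  NextPhrase-++-stable : {s u w : List A} {prev : List (List A)} {f y : List A} →
    NextPhrase (s ++ u) prev y → NextPhrase s prev f → concat prev ++ y ++ w ≡ s → y ≡ f
  NextPhrase-++-stable {u = u} {w} {prev} {f} {y}
    npy@(_ , _ , refl , _ , src-y , _) npf@(_ , _ , refl , _ , src-f , _) refl =
    IsPrefix-unique (w , refl) f≤rest (≤-antisym y≤f f≤y)
    where
    f≤rest = NextPhrase-prefix npf refl
    y≤f = NextPhrase-longest npf refl (w , refl) src-y
    f≤y = NextPhrase-longest npy (sym (++-assoc (concat prev) (y ++ w) u))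
            (IsPrefix-trans f≤rest (u , refl)) src-f

  -- The part of rest covered by concat xs, extended by the first letter of x, is a
  -- candidate for f.
  NextPhrase-overlap-≤ : {s rest : List A} {prev xs : List (List A)} {f x t : List A} →
    NextPhrase s prev f → concat prev ++ rest ≡ s → IsPrefix xs prev →
    concat xs ++ x ≡ t ++ rest → x ≢ [] → length (concat xs) ≤ length (t ++ f)
  NextPhrase-overlap-≤ {x = []} _ _ _ _ x≢[] = ⊥-elim (x≢[] refl)
  NextPhrase-overlap-≤ {rest = rest} {xs = xs} {f} {d ∷ u} {t} np rest≡ xs≤prev eq _ = ≮⇒≥ too-long
    where
    too-long : ¬ length (t ++ f) < length (concat xs)
    too-long lt with ++-split (concat xs) (d ∷ u) t rest eq (≤-trans (length-++-≤ˡ t) (<⇒≤ lt))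
    ... | q , xs≡tq , q++du≡rest = <⇒≱ (<-trans f<q (length-<-++ q λ ())) qd≤f
      where
      qd≤f : length (q ++ [ d ]) ≤ length f
      qd≤f = NextPhrase-longest np rest≡ (u , trans (++-assoc q [ d ] u) q++du≡rest)
               (SuffixOfSomePrefixParse-intro xs≤prev (t , sym xs≡tq))
      f<q : length f < length q
      f<q = +-cancelˡ-< (length t) (length f) (length q)
              (subst₂ _<_ (length-++ t) (trans (cong length xs≡tq) (length-++ t)) lt)

  -- p starts no later than f and p c ends where T does, so f ++ T minus its last letter
  -- is a suffix of p and would have been a longer choice for f.
  NextPhrase-not-covered : {s T p b us : List A} {prev : List (List A)} {f : List A} {c : A} →
    NextPhrase s prev f → concat prev ++ f ++ T ≡ s → T ≢ [] → SuffixOfSomePrefixParse prev p →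
    b ++ p ++ [ c ] ≡ us ++ f ++ T → length b ≤ length us → ⊥
  NextPhrase-not-covered {T = T} np rest≡ T≢[] _ _ _ with initLast T
  NextPhrase-not-covered np rest≡ T≢[] _ _ _ | [] = T≢[] refl
  NextPhrase-not-covered {p = p} {b} {us} {f = f} np rest≡ _ src eq b≤us | T′ ∷ʳ′ d =
    <⇒≱ (≤-<-trans (length-++-≤ˡ f) (length-<-++ (f ++ T′) λ ())) (NextPhrase-longest np rest≡ fTd≤ fT′-src)
    where
    fTd≤ : IsPrefix ((f ++ T′) ++ [ d ]) (f ++ T′ ++ [ d ])
    fTd≤ = [] , trans (++-identityʳ _) (++-assoc f T′ [ d ])
    fT′-src : SuffixOfSomePrefixParse _ (f ++ T′)
    fT′-src = SuffixOfSomePrefixParse-suffix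
      (∷ʳ-overlap-suffix b p us (f ++ T′) (trans eq (cong (us ++_) (sym (++-assoc f T′ [ d ]))))
        b≤us)
      src

  IsLZEnd-phrase : {s : List A} {fs : List (List A)} → IsLZEnd s fs →
    (xs : List (List A)) {y : List A} {ys : List (List A)} → fs ≡ xs ++ y ∷ ys → NextPhrase s xs y
  IsLZEnd-phrase (_ , phrase) xs {y} {ys} refl with lookup-length-++ xs y ys
  ... | i , i≡ , lookup≡ = subst₂ (NextPhrase _) take≡ lookup≡ (phrase i)
    where
    take≡ : take (toℕ i) (xs ++ y ∷ ys) ≡ xs
    take≡ = trans (cong (λ n → take n (xs ++ y ∷ ys)) i≡) (take-length-++ xs (y ∷ ys))

  IsLZEnd-concat : {s : List A} {fs : List (List A)} → IsLZEnd s fs →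
    (xs : List (List A)) {ys : List (List A)} → fs ≡ xs ++ ys → concat xs ++ concat ys ≡ s
  IsLZEnd-concat (concat≡ , _) xs {ys} refl = trans (concat-++ xs ys) concat≡

  IsLZEnd-shared-phrase : {s : List A} {a : A} {fs gs xs zs : List (List A)} {y : List A} →
    IsLZEnd s fs → IsLZEnd (s ++ [ a ]) gs → gs ≡ xs ++ y ∷ zs → zs ≢ [] →
    IsPrefix xs fs → IsPrefix (xs ++ [ y ]) fs
  IsLZEnd-shared-phrase {zs = []} _ _ _ zs≢[] _ = ⊥-elim (zs≢[] refl)
  IsLZEnd-shared-phrase {s} {xs = xs} {z ∷ zs} {y} lz lz′ gs≡ _ (r , r-extends)
    with ++-∷ʳ-prefix (concat xs ++ y) (z ++ concat zs) s
           (trans (++-assoc (concat xs) y _) (IsLZEnd-concat lz′ xs gs≡)) tail≢[]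
    where
    tail≢[] : z ++ concat zs ≢ []
    tail≢[] e = NextPhrase-nonempty (IsLZEnd-phrase lz′ (xs ++ [ y ]) (trans gs≡ (sym (++-assoc xs [ y ] (z ∷ zs)))))
                  (++-conicalˡ z _ e)
  ... | w , xsyw≡s = shared r r-extends
    where
    xys≡s : concat xs ++ y ++ w ≡ s
    xys≡s = trans (sym (++-assoc (concat xs) y w)) xsyw≡s
    npy : NextPhrase (s ++ _) xs y
    npy = IsLZEnd-phrase lz′ xs gs≡
    concat-r : (r : List (List A)) → xs ++ r ≡ _ → concat r ≡ y ++ w
    concat-r r e = ++-cancelˡ (concat xs) (concat r) (y ++ w) (trans (IsLZEnd-concat lz xs (sym e)) (sym xys≡s))
    shared : (r : List (List A)) → xs ++ r ≡ _ → IsPrefix (xs ++ [ y ]) _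
    shared []      e = ⊥-elim (NextPhrase-nonempty npy (++-conicalˡ y w (sym (concat-r [] e))))
    shared (f ∷ r) e with NextPhrase-++-stable npy (IsLZEnd-phrase lz xs (sym e)) xys≡s
    ... | refl = r , trans (++-assoc xs [ y ] r) e

  IsLZEnd-init-shared : {s : List A} {a : A} {fs gs : List (List A)} {g : List A} →
    IsLZEnd s fs → IsLZEnd (s ++ [ a ]) (gs ++ [ g ]) → IsPrefix gs fs
  IsLZEnd-init-shared {fs = fs} {gs} {g} lz lz′ = extend [] gs refl (fs , refl)
    where
    extend : (xs zs : List (List A)) → xs ++ zs ≡ gs → IsPrefix xs fs → IsPrefix gs fs
    extend xs []       xs≡gs xs≤fs = subst (λ ys → IsPrefix ys fs) (trans (sym (++-identityʳ xs)) xs≡gs) xs≤fs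
    extend xs (y ∷ zs) xyzs≡gs xs≤fs =
      extend (xs ++ [ y ]) zs (trans (++-assoc xs [ y ] zs) xyzs≡gs)
        (IsLZEnd-shared-phrase lz lz′ gs≡ (∷ʳ-≢-[] zs) xs≤fs)
      where
      gs≡ : gs ++ [ g ] ≡ xs ++ y ∷ zs ++ [ g ]
      gs≡ = trans (cong (_++ [ g ]) (sym xyzs≡gs)) (++-assoc xs (y ∷ zs) [ g ])

  IsLZEnd-last-phrase : {s : List A} {a : A} {gs r : List (List A)} {g : List A} →
    IsLZEnd s (gs ++ r) → IsLZEnd (s ++ [ a ]) (gs ++ [ g ]) →
    g ≡ concat r ++ [ a ] × SuffixOfSomePrefixParse gs (concat r)
  IsLZEnd-last-phrase {s} {a} {gs} {r} {g} lz lz′ with IsLZEnd-phrase lz′ gs {g} {[]} refl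
  ... | p , c , refl , _ , src , _ = g≡ , subst (SuffixOfSomePrefixParse gs) (∷ʳ-injectiveˡ p (concat r) g≡) src
    where
    open ≡-Reasoning
    g≡ : p ++ [ c ] ≡ concat r ++ [ a ]
    g≡ = ++-cancelˡ (concat gs) _ _ (begin
      concat gs ++ p ++ [ c ]          ≡⟨ cong (concat gs ++_) (++-identityʳ _) ⟨
      concat gs ++ (p ++ [ c ]) ++ []  ≡⟨ IsLZEnd-concat lz′ gs refl ⟩
      s ++ [ a ]                       ≡⟨ cong (_++ [ a ]) (IsLZEnd-concat lz gs refl) ⟨
      (concat gs ++ concat r) ++ [ a ] ≡⟨ ++-assoc (concat gs) (concat r) [ a ] ⟩
      concat gs ++ concat r ++ [ a ]   ∎)

  three-phrases-not-suffix : {s : List A} {fs prev fs′ : List (List A)} {f₁ f₂ f₃ : List A} →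
    IsLZEnd s fs → fs ≡ prev ++ f₁ ∷ f₂ ∷ f₃ ∷ fs′ →
    ¬ SuffixOfSomePrefixParse prev (concat (f₁ ∷ f₂ ∷ f₃ ∷ fs′))
  three-phrases-not-suffix {fs′ = fs′} {f₁} {f₂} {f₃} lz refl src with SuffixOfSomePrefixParse-witness src
  ... | xs , (ys , refl) , (t , tR≡xs) with initLast xs
  ... | [] = NextPhrase-nonempty (IsLZEnd-phrase lz ys refl) (++-conicalˡ f₁ _ (++-conicalʳ t _ tR≡xs))
  ... | X ∷ʳ′ x with IsLZEnd-phrase lz X (trans (++-assoc (X ++ [ x ]) ys _) (++-assoc X [ x ] _))
  ... | px , cx , refl , _ , src-x , _ =
    NextPhrase-not-covered {b = concat X} {t ++ f₁} np₂ (IsLZEnd-concat lz (prev ++ [ f₁ ]) fs≡) f₃⋯≢[] src-px Xx≡tf₁⋯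
      (NextPhrase-overlap-≤ {t = t} np₁ (IsLZEnd-concat lz prev refl) X≤prev Xx≡tR (∷ʳ-≢-[] px))
    where
    prev = (X ++ [ px ++ [ cx ] ]) ++ ys
    X≤prev : IsPrefix X prev
    X≤prev = (px ++ [ cx ]) ∷ ys , sym (++-assoc X _ ys)
    fs≡ : prev ++ f₁ ∷ f₂ ∷ f₃ ∷ fs′ ≡ (prev ++ [ f₁ ]) ++ f₂ ∷ f₃ ∷ fs′
    fs≡ = sym (++-assoc prev [ f₁ ] _)
    np₁ = IsLZEnd-phrase lz prev refl
    np₂ = IsLZEnd-phrase lz (prev ++ [ f₁ ]) fs≡
    f₃⋯≢[] : f₃ ++ concat fs′ ≢ []
    f₃⋯≢[] e = NextPhrase-nonempty (IsLZEnd-phrase lz (prev ++ f₁ ∷ f₂ ∷ []) (sym (++-assoc prev _ _)))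
                 (++-conicalˡ f₃ _ e)
    src-px : SuffixOfSomePrefixParse (prev ++ [ f₁ ]) px
    src-px = SuffixOfSomePrefixParse-mono (IsPrefix-trans X≤prev ([ f₁ ] , refl)) src-x
    Xx≡tR : concat X ++ px ++ [ cx ] ≡ t ++ concat (f₁ ∷ f₂ ∷ f₃ ∷ fs′)
    Xx≡tR = trans (cong (concat X ++_) (sym (++-identityʳ _))) (trans (concat-++ X [ _ ]) (sym tR≡xs))
    Xx≡tf₁⋯ : concat X ++ px ++ [ cx ] ≡ (t ++ f₁) ++ f₂ ++ f₃ ++ concat fs′
    Xx≡tf₁⋯ = trans Xx≡tR (sym (++-assoc t f₁ _))

  at-most-two-trailing-phrases : {s : List A} {gs r : List (List A)} →
    IsLZEnd s (gs ++ r) → SuffixOfSomePrefixParse gs (concat r) →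
    r ≡ [] ⊎ (∃ λ f → r ≡ [ f ]) ⊎ (∃₂ λ f f′ → r ≡ f ∷ f′ ∷ [])
  at-most-two-trailing-phrases {r = []}               _  _   = inj₁ refl
  at-most-two-trailing-phrases {r = f ∷ []}           _  _   = inj₂ (inj₁ (f , refl))
  at-most-two-trailing-phrases {r = f ∷ f′ ∷ []}      _  _   = inj₂ (inj₂ (f , f′ , refl))
  at-most-two-trailing-phrases {r = _ ∷ _ ∷ _ ∷ _}    lz src = ⊥-elim (three-phrases-not-suffix lz refl src)

lemma3 : {A : Set} (s : List A) (fs : List (List A)) → IsLZEnd s fs →
    (a : A) (gs : List (List A)) → IsLZEnd (s ++ [ a ]) gs →
    Σ (List (List A)) λ gs′ → Σ (List A) λ g → gs ≡ gs′ ++ [ g ] ×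
      ((Σ (List (List A)) λ fs′ → Σ (List A) λ f′ → Σ (List A) λ fz →
          fs ≡ fs′ ++ f′ ∷ fz ∷ [] × g ≡ f′ ++ fz ++ [ a ])
       ⊎ (Σ (List (List A)) λ fs′ → Σ (List A) λ fz →
          fs ≡ fs′ ++ [ fz ] × g ≡ fz ++ [ a ])
       ⊎ g ≡ [ a ])
lemma3 s fs lz a gs lz′ with initLast gs
... | [] = ⊥-elim (∷ʳ-≢-[] s (sym (proj₁ lz′)))
... | gs′ ∷ʳ′ g with IsLZEnd-init-shared lz lz′
... | r , refl with IsLZEnd-last-phrase lz lz′
... | refl , src with at-most-two-trailing-phrases lz src
... | inj₁ refl = gs′ , _ , refl , inj₂ (inj₂ refl)
... | inj₂ (inj₁ (fz , refl)) =
  gs′ , _ , refl , inj₂ (inj₁ (gs′ , fz , refl , cong (_++ [ a ]) (++-identityʳ fz)))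
... | inj₂ (inj₂ (f′ , fz , refl)) =
  gs′ , _ , refl , inj₁ (gs′ , f′ , fz , refl ,
    trans (cong (λ u → (f′ ++ u) ++ [ a ]) (++-identityʳ fz)) (++-assoc f′ fz [ a ]))
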